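{- Let $k$ be odd and let $C_1=x_1-\cdots-x_k-x_1$ and $C_2=y_1-\cdots-y_k-y_1$ be two disjoint cycles of length $k$. Let $G$ be the graph consisting of $C_1$ and $C_2$ together with the edges $x_iy_i$, $i=1,\dots,k$. Suppose we have an assignment of sets $S(v)\subseteq\mathbb{Z}$ with $|S(v)|=3$ for all vertices $v$ of $C_2$. Then there is at most one proper coloring $c:V(C_1)\to\mathbb{Z}$ of $C_1$ which cannot be extended to a proper coloring of $G$ assigning to each vertex $v$ of $C_2$ a color from $S(v)$. -}

module Defs where

open import Data.Nat using (ℕ; suc; _+_; _%_; NonZero)
open import Data.Integer using (ℤ)
open import Data.Fin using (Fin; toℕ)
open import Data.List using (List; length)
open import Data.List.Membership.Propositional using (_∈_)
open import Data.List.Relation.Unary.Unique.Propositional using (Unique)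
open import Data.Product using (_×_; ∃)
open import Relation.Binary.PropositionalEquality using (_≡_; _≢_)
open import Relation.Nullary using (¬_)

CycleEdge : (k : ℕ) → .{{_ : NonZero k}} → Fin k → Fin k → Set
CycleEdge k i j = toℕ j ≡ (toℕ i + 1) % k

ProperOnCycle : (k : ℕ) → .{{_ : NonZero k}} → (Fin k → ℤ) → Set
ProperOnCycle k c = ∀ i j → CycleEdge k i j → c i ≢ c j

ListAssignment3 : ℕ → Set
ListAssignment3 k = Fin k → List ℤ

IsSize3 : ∀ {k} → ListAssignment3 k → Set
IsSize3 {k} S = ∀ (i : Fin k) → Unique (S i) × length (S i) ≡ 3

-- c (colouring of C₁ = x₁…x_k) extends to a proper colouring of G where
-- y_i gets a colour d i ∈ S(y_i): d is proper on C₂ and d i ≠ c i (edge x_i y_i).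
Extendable : (k : ℕ) → .{{_ : NonZero k}} → ListAssignment3 k → (Fin k → ℤ) → Set
Extendable k S c =
  ∃ λ (d : Fin k → ℤ) →
    (∀ i → d i ∈ S i) × ProperOnCycle k d × (∀ i → d i ≢ c i)

-- Fix a vertex x_i with successor x_{i+1}, and let c be a proper colouring of C₁ that does
-- not extend. For every colour α ∈ S(y_{i+1}) other than c(x_{i+1}), at most one colour of
-- S(y_i) avoids both c(x_i) and α: given two, colour y_{i+1} with α, go greedily around C₂
-- (each y_j has three colours and only two constraints, c(x_j) and its predecessor), and
-- finish at y_i with whichever of the two differs from its predecessor. Applied to two such
-- α this forces S(y_i) = {c(x_i), α₁, α₂} and c(x_i) ∉ S(y_{i+1}), so c(x_i) is the only
-- colour of S(y_i) missing from S(y_{i+1}), which does not depend on c.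
module Submission where

open import Defs
open import Data.Nat using (ℕ; zero; suc; _+_; _∸_; _%_; _≤_; _<_; NonZero; z≤n; s≤s)
open import Data.Nat.Properties
  using (+-comm; +-assoc; +-identityʳ; m+[n∸m]≡n; ≤-reflexive; <⇒≤; <⇒≱; ≤∧≢⇒<; n<1+n)
  renaming (_≟_ to _≟ℕ_)
open import Data.Nat.DivMod using (m%n<n; m<n⇒m%n≡m; %-distribˡ-+; m%n%n≡m%n; [m+n]%n≡m%n; n%n≡0)
open import Data.Integer using (ℤ)
open import Data.Integer.Properties using (_≟_)
open import Data.Fin using (Fin; toℕ; fromℕ<)
open import Data.Fin.Properties using (toℕ-fromℕ<; toℕ-injective; toℕ<n)
open import Data.List using (List; []; _∷_; length)
open import Data.List.Properties using (length-removeAt′)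
open import Data.List.Relation.Unary.Any using (here; there; _─_)
open import Data.List.Relation.Unary.All as All using (All; []; _∷_; all?)
open import Data.List.Relation.Unary.All.Properties using (¬All⇒Any¬)
open import Data.List.Relation.Unary.AllPairs using ([]; _∷_)
open import Data.List.Relation.Unary.Unique.Propositional using (Unique)
open import Data.List.Membership.Propositional using (_∈_; _∉_; find)
open import Data.List.Membership.Propositional.Properties using (∈-++⁺ˡ)
import Data.List.Membership.DecPropositional as DecMembership
open import Data.Product using (_×_; _,_; proj₁; proj₂; ∃; ∃₂)
open import Relation.Binary.Definitions using (DecidableEquality)
open import Relation.Binary.PropositionalEquality
  using (_≡_; _≢_; refl; sym; trans; cong; subst; subst₂; module ≡-Reasoning)
open import Relation.Nullary using (¬_; yes; no; contradiction)
open import Function using (_∘_)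

open ≡-Reasoning

module _ {a} {A : Set a} where

  ∈-─ : ∀ {x y} {xs : List A} (y∈xs : y ∈ xs) → x ∈ xs → x ≢ y → x ∈ (xs ─ y∈xs)
  ∈-─ (here refl)  (here refl)  x≢y = contradiction refl x≢y
  ∈-─ (here refl)  (there x∈xs) _   = x∈xs
  ∈-─ (there _)    (here refl)  _   = here refl
  ∈-─ (there y∈xs) (there x∈xs) x≢y = there (∈-─ y∈xs x∈xs x≢y)

  Unique⇒length≤ : ∀ {xs ys : List A} → Unique xs → All (_∈ ys) xs → length xs ≤ length ys
  Unique⇒length≤ {[]}          _             _              = z≤n
  Unique⇒length≤ {x ∷ xs} {ys} (x≢xs ∷ uniq) (x∈ys ∷ xs⊆ys) =
    subst (suc (length xs) ≤_) (sym (length-removeAt′ ys _))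
      (s≤s (Unique⇒length≤ uniq (All.zipWith (λ (y∈ys , x≢y) → ∈-─ x∈ys y∈ys (x≢y ∘ sym))
                                             (xs⊆ys , x≢xs))))

  TwoOutside : List A → List A → Set a
  TwoOutside L F = ∃₂ λ β₁ β₂ → β₁ ≢ β₂ × (β₁ ∈ L × β₁ ∉ F) × (β₂ ∈ L × β₂ ∉ F)

  TwoOutside-weaken : ∀ {L F F′} → (∀ {x} → x ∈ L → x ∉ F → x ∉ F′) → TwoOutside L F → TwoOutside L F′
  TwoOutside-weaken F⇒F′ (β₁ , β₂ , β₁≢β₂ , (β₁∈L , β₁∉F) , (β₂∈L , β₂∉F)) =
    β₁ , β₂ , β₁≢β₂ , (β₁∈L , F⇒F′ β₁∈L β₁∉F) , (β₂∈L , F⇒F′ β₂∈L β₂∉F)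

  _∖_≡⁅_⁆ : List A → List A → A → Set a
  L ∖ L′ ≡⁅ x ⁆ = (x ∈ L × x ∉ L′) × (∀ {y} → y ∈ L → y ∉ L′ → y ≡ x)

  ∖≡⁅⁆-unique : ∀ {L L′ x y} → L ∖ L′ ≡⁅ x ⁆ → L ∖ L′ ≡⁅ y ⁆ → x ≡ y
  ∖≡⁅⁆-unique ((x∈L , x∉L′) , _) (_ , only-y) = only-y x∈L x∉L′

module _ {a} {A : Set a} (_≟ᴬ_ : DecidableEquality A) where
  open DecMembership _≟ᴬ_ using (_∈?_)

  fresh : ∀ {L F : List A} → Unique L → length F < length L → ∃ λ x → x ∈ L × x ∉ F
  fresh {L} {F} uniq F<L with all? (_∈? F) L
  ... | yes L⊆F = contradiction (Unique⇒length≤ uniq L⊆F) (<⇒≱ F<L)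
  ... | no  L⊈F = find (¬All⇒Any¬ (_∈? F) L L⊈F)

  twoFresh : ∀ {L F : List A} → Unique L → 2 + length F ≤ length L → TwoOutside L F
  twoFresh {F = F} uniq 2+F≤L with fresh {F = F} uniq (<⇒≤ 2+F≤L)
  ... | β₁ , β₁∈L , β₁∉F with fresh {F = β₁ ∷ F} uniq 2+F≤L
  ... | β₂ , β₂∈L , β₂∉β₁∷F =
    β₁ , β₂ , (λ { refl → β₂∉β₁∷F (here refl) }) , (β₁∈L , β₁∉F) , (β₂∈L , λ β₂∈F → β₂∉β₁∷F (there β₂∈F))

  TwoOutside⇒outside-∷ : ∀ {L F} → TwoOutside L F → ∀ x → ∃ λ β → β ∈ L × β ∉ x ∷ F
  TwoOutside⇒outside-∷ (β₁ , β₂ , β₁≢β₂ , (β₁∈L , β₁∉F) , (β₂∈L , β₂∉F)) x with β₁ ≟ᴬ x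
  ... | no  β₁≢x = β₁ , β₁∈L , λ { (here β₁≡x) → β₁≢x β₁≡x ; (there β₁∈F) → β₁∉F β₁∈F }
  ... | yes refl = β₂ , β₂∈L , λ { (here refl) → β₁≢β₂ refl ; (there β₂∈F) → β₂∉F β₂∈F }

  ¬TwoOutside⇒pair⊆ : ∀ {L a b} → Unique L → 3 ≤ length L → ¬ TwoOutside L (a ∷ b ∷ []) →
                      a ∈ L × b ∈ L × a ≢ b
  ¬TwoOutside⇒pair⊆ {L} {a} {b} uniq 3≤L blocked with a ∈? L | b ∈? L | a ≟ᴬ b
  ... | yes a∈L | yes b∈L | no a≢b = a∈L , b∈L , a≢b
  -- Otherwise a ∷ b ∷ [] excludes at most one element of L, which leaves two.
  ... | no a∉L | _ | _ =
    contradiction (TwoOutside-weaken (λ { x∈L _ (here refl) → a∉L x∈L ; _ x∉[b] (there x∈[b]) → x∉[b] x∈[b] })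
                                     (twoFresh {F = b ∷ []} uniq 3≤L))
                  blocked
  ... | yes _ | no b∉L | _ =
    contradiction (TwoOutside-weaken (λ { _ x∉[a] (here x≡a) → x∉[a] (here x≡a) ; x∈L _ (there (here refl)) → b∉L x∈L })
                                     (twoFresh {F = a ∷ []} uniq 3≤L))
                  blocked
  ... | yes _ | yes _ | yes refl =
    contradiction (TwoOutside-weaken (λ { _ x∉[a] (here x≡a) → x∉[a] (here x≡a) ; _ x∉[a] (there (here x≡a)) → x∉[a] (here x≡a) })
                                     (twoFresh {F = a ∷ []} uniq 3≤L))
                  blocked

[m%d+n]%d≡[m+n]%d : ∀ m n d .{{_ : NonZero d}} → (m % d + n) % d ≡ (m + n) % d
[m%d+n]%d≡[m+n]%d m n d = begin
  (m % d + n) % d          ≡⟨ %-distribˡ-+ (m % d) n d ⟩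
  (m % d % d + n % d) % d  ≡⟨ cong (λ r → (r + n % d) % d) (m%n%n≡m%n m d) ⟩
  (m % d + n % d) % d      ≡⟨ %-distribˡ-+ m n d ⟨
  (m + n) % d              ∎

[m+n%d]%d≡[m+n]%d : ∀ m n d .{{_ : NonZero d}} → (m + n % d) % d ≡ (m + n) % d
[m+n%d]%d≡[m+n]%d m n d = begin
  (m + n % d) % d  ≡⟨ cong (_% d) (+-comm m (n % d)) ⟩
  (n % d + m) % d  ≡⟨ [m%d+n]%d≡[m+n]%d n m d ⟩
  (n + m) % d      ≡⟨ cong (_% d) (+-comm n m) ⟩
  (m + n) % d      ∎

n∸1≡1+[n∸2] : ∀ {n} → 2 ≤ n → n ∸ 1 ≡ suc (n ∸ 2)
n∸1≡1+[n∸2] (s≤s (s≤s _)) = refl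

module _ {k : ℕ} .{{_ : NonZero k}} where

  toℕ%k : (i : Fin k) → toℕ i % k ≡ toℕ i
  toℕ%k i = m<n⇒m%n≡m (toℕ<n i)

  rotate : Fin k → ℕ → Fin k
  rotate i t = fromℕ< (m%n<n (toℕ i + t) k)

  toℕ-rotate : ∀ i t → toℕ (rotate i t) ≡ (toℕ i + t) % k
  toℕ-rotate i t = toℕ-fromℕ< (m%n<n (toℕ i + t) k)

  rotate-zero : ∀ i → rotate i 0 ≡ i
  rotate-zero i = toℕ-injective (begin
    toℕ (rotate i 0)  ≡⟨ toℕ-rotate i 0 ⟩
    (toℕ i + 0) % k   ≡⟨ cong (_% k) (+-identityʳ (toℕ i)) ⟩
    toℕ i % k         ≡⟨ toℕ%k i ⟩
    toℕ i             ∎)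

  rotate-full : ∀ i → rotate i k ≡ i
  rotate-full i = toℕ-injective (begin
    toℕ (rotate i k)  ≡⟨ toℕ-rotate i k ⟩
    (toℕ i + k) % k   ≡⟨ [m+n]%n≡m%n (toℕ i) k ⟩
    toℕ i % k         ≡⟨ toℕ%k i ⟩
    toℕ i             ∎)

  rotate-+ : ∀ i s t → rotate (rotate i s) t ≡ rotate i (s + t)
  rotate-+ i s t = toℕ-injective (begin
    toℕ (rotate (rotate i s) t)  ≡⟨ toℕ-rotate (rotate i s) t ⟩
    (toℕ (rotate i s) + t) % k   ≡⟨ cong (λ r → (r + t) % k) (toℕ-rotate i s) ⟩
    ((toℕ i + s) % k + t) % k    ≡⟨ [m%d+n]%d≡[m+n]%d (toℕ i + s) t k ⟩
    (toℕ i + s + t) % k          ≡⟨ cong (_% k) (+-assoc (toℕ i) s t) ⟩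
    (toℕ i + (s + t)) % k        ≡⟨ toℕ-rotate i (s + t) ⟨
    toℕ (rotate i (s + t))       ∎)

  edge-rotate-1 : ∀ i → CycleEdge k i (rotate i 1)
  edge-rotate-1 i = toℕ-rotate i 1

  distance : Fin k → Fin k → ℕ
  distance i j = (k ∸ toℕ i + toℕ j) % k

  distance<k : ∀ i j → distance i j < k
  distance<k i j = m%n<n (k ∸ toℕ i + toℕ j) k

  rotate-distance : ∀ i j → rotate i (distance i j) ≡ j
  rotate-distance i j = toℕ-injective (begin
    toℕ (rotate i (distance i j))          ≡⟨ toℕ-rotate i (distance i j) ⟩
    (toℕ i + (k ∸ toℕ i + toℕ j) % k) % k  ≡⟨ [m+n%d]%d≡[m+n]%d (toℕ i) (k ∸ toℕ i + toℕ j) k ⟩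
    (toℕ i + (k ∸ toℕ i + toℕ j)) % k      ≡⟨ cong (_% k) (+-assoc (toℕ i) (k ∸ toℕ i) (toℕ j)) ⟨
    (toℕ i + (k ∸ toℕ i) + toℕ j) % k      ≡⟨ cong (λ r → (r + toℕ j) % k) (m+[n∸m]≡n (<⇒≤ (toℕ<n i))) ⟩
    (k + toℕ j) % k                        ≡⟨ cong (_% k) (+-comm k (toℕ j)) ⟩
    (toℕ j + k) % k                        ≡⟨ [m+n]%n≡m%n (toℕ j) k ⟩
    toℕ j % k                              ≡⟨ toℕ%k j ⟩
    toℕ j                                  ∎)

  distance-edge : ∀ i {j j′} → CycleEdge k j j′ → distance i j′ ≡ (distance i j + 1) % k
  distance-edge i {j} {j′} j→j′ = begin
    (k ∸ toℕ i + toℕ j′) % k           ≡⟨ cong (λ r → (k ∸ toℕ i + r) % k) j→j′ ⟩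
    (k ∸ toℕ i + (toℕ j + 1) % k) % k  ≡⟨ [m+n%d]%d≡[m+n]%d (k ∸ toℕ i) (toℕ j + 1) k ⟩
    (k ∸ toℕ i + (toℕ j + 1)) % k      ≡⟨ cong (_% k) (+-assoc (k ∸ toℕ i) (toℕ j) 1) ⟨
    (k ∸ toℕ i + toℕ j + 1) % k        ≡⟨ [m%d+n]%d≡[m+n]%d (k ∸ toℕ i + toℕ j) 1 k ⟨
    (distance i j + 1) % k             ∎

  -- e t is the colour of the vertex t steps after i.
  proper-along : ∀ (i : Fin k) (e : ℕ → ℤ) → (∀ t → e (suc t) ≢ e t) → e (k ∸ 1) ≢ e 0 →
                 ProperOnCycle k (λ j → e (distance i j))
  proper-along i e e-step e-closed j j′ j→j′ with suc (distance i j) ≟ℕ k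
  ... | yes last = subst₂ (λ s t → e s ≢ e t) (sym j-last) (sym j′-first) e-closed
    where
    j-last : distance i j ≡ k ∸ 1
    j-last = cong (_∸ 1) last
    j′-first : distance i j′ ≡ 0
    j′-first = trans (distance-edge i j→j′) (trans (cong (_% k) (trans (+-comm _ 1) last)) (n%n≡0 k))
  ... | no notLast = subst (λ t → e (distance i j) ≢ e t) (sym j′-next) (λ eq → e-step _ (sym eq))
    where
    j′-next : distance i j′ ≡ suc (distance i j)
    j′-next = trans (distance-edge i j→j′)
                (trans (cong (_% k) (+-comm _ 1)) (m<n⇒m%n≡m (≤∧≢⇒< (distance<k i j) notLast)))

size3⇒3≤length : ∀ {k} {S : ListAssignment3 k} → IsSize3 S → ∀ i → 3 ≤ length (S i)
size3⇒3≤length size3 i = ≤-reflexive (sym (proj₂ (size3 i)))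

extend-greedily : ∀ k .{{_ : NonZero k}} → 2 ≤ k → (S : ListAssignment3 k) → IsSize3 S →
                  (c : Fin k → ℤ) (i : Fin k) {α : ℤ} → α ∈ S (rotate i 1) → α ≢ c (rotate i 1) →
                  TwoOutside (S i) (c i ∷ α ∷ []) → Extendable k S c
extend-greedily k 2≤k S size3 c i {α} α∈S α≢c twoOutside =
  d , d∈S , proper-along i₁ e e-step e-closed , d≢c
  where
  i₁ : Fin k
  i₁ = rotate i 1

  walk : ℕ → Fin k
  walk = rotate i₁

  walk-last : walk (k ∸ 1) ≡ i
  walk-last = trans (rotate-+ i 1 (k ∸ 1)) (trans (cong (rotate i) (m+[n∸m]≡n (<⇒≤ 2≤k))) (rotate-full i))

  -- The walk ends at i, whose successor y_{i+1} was coloured α first.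
  Next : ℕ → ℤ → ℤ → Set
  Next t prev m = m ∈ S (walk (suc t)) × m ∉ prev ∷ c (walk (suc t)) ∷ [] × (suc t ≡ k ∸ 1 → m ≢ α)

  next : ∀ t prev → ∃ (Next t prev)
  next t prev with suc t ≟ℕ k ∸ 1
  ... | no notLast =
    let m , m∈S , m∉ = fresh _≟_ (proj₁ (size3 (walk (suc t)))) (size3⇒3≤length size3 (walk (suc t)))
    in m , m∈S , m∉ , λ last → contradiction last notLast
  ... | yes last rewrite last | walk-last =
    let β , β∈S , β∉ = TwoOutside⇒outside-∷ _≟_ twoOutside prev
    in β , β∈S , (λ β∈ → β∉ (∈-++⁺ˡ β∈)) , λ _ β≡α → β∉ (there (there (here β≡α)))

  e : ℕ → ℤ
  e zero    = α
  e (suc t) = proj₁ (next t (e t))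

  e-valid : ∀ t → e t ∈ S (walk t) × e t ≢ c (walk t)
  e-valid zero rewrite rotate-zero i₁ = α∈S , α≢c
  e-valid (suc t) = let m∈S , m∉ , _ = proj₂ (next t (e t)) in m∈S , λ eq → m∉ (there (here eq))

  e-step : ∀ t → e (suc t) ≢ e t
  e-step t = let _ , m∉ , _ = proj₂ (next t (e t)) in m∉ ∘ here

  e-closed : e (k ∸ 1) ≢ α
  e-closed = let _ , _ , m≢α = proj₂ (next (k ∸ 2) (e (k ∸ 2)))
             in subst (λ n → e n ≢ α) (sym last) (m≢α (sym last))
    where
    last : k ∸ 1 ≡ suc (k ∸ 2)
    last = n∸1≡1+[n∸2] 2≤k

  d : Fin k → ℤ
  d j = e (distance i₁ j)

  d∈S : ∀ j → d j ∈ S j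
  d∈S j = subst (λ v → d j ∈ S v) (rotate-distance i₁ j) (proj₁ (e-valid _))

  d≢c : ∀ j → d j ≢ c j
  d≢c j = subst (λ v → d j ≢ c v) (rotate-distance i₁ j) (proj₂ (e-valid _))

nonExtendable⇒missing-colour : ∀ k .{{_ : NonZero k}} → 2 ≤ k → (S : ListAssignment3 k) → IsSize3 S →
                               (c : Fin k → ℤ) → ProperOnCycle k c → ¬ Extendable k S c →
                               ∀ i → S i ∖ S (rotate i 1) ≡⁅ c i ⁆
nonExtendable⇒missing-colour k 2≤k S size3 c c-proper ¬ext i
  with twoFresh _≟_ {F = c (rotate i 1) ∷ []} (proj₁ (size3 (rotate i 1))) (size3⇒3≤length size3 (rotate i 1))
... | α₁ , α₂ , α₁≢α₂ , (α₁∈S₁ , α₁∉) , (α₂∈S₁ , α₂∉) = (c-i∈S₀ , c-i∉S₁) , only-c-i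
  where
  S₀ S₁ : List ℤ
  S₀ = S i
  S₁ = S (rotate i 1)

  forced : ∀ {α} → α ∈ S₁ → α ≢ c (rotate i 1) → c i ∈ S₀ × α ∈ S₀ × c i ≢ α
  forced α∈S₁ α≢c = ¬TwoOutside⇒pair⊆ _≟_ (proj₁ (size3 i)) (size3⇒3≤length size3 i)
                      (λ two → ¬ext (extend-greedily k 2≤k S size3 c i α∈S₁ α≢c two))

  c-i∈S₀ : c i ∈ S₀
  c-i∈S₀ = proj₁ (forced α₁∈S₁ (α₁∉ ∘ here))

  c-i∉S₁ : c i ∉ S₁
  c-i∉S₁ c-i∈S₁ = proj₂ (proj₂ (forced c-i∈S₁ (c-proper i (rotate i 1) (edge-rotate-1 i)))) refl

  -- c i, α₁ and α₂ already fill the three places of S₀.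
  only-c-i : ∀ {y} → y ∈ S₀ → y ∉ S₁ → y ≡ c i
  only-c-i {y} y∈S₀ y∉S₁ with y ≟ c i
  ... | yes y≡c-i = y≡c-i
  ... | no  y≢c-i with forced α₁∈S₁ (α₁∉ ∘ here) | forced α₂∈S₁ (α₂∉ ∘ here)
  ... | _ , α₁∈S₀ , c-i≢α₁ | _ , α₂∈S₀ , c-i≢α₂ =
    contradiction (subst (4 ≤_) (proj₂ (size3 i)) (Unique⇒length≤ distinct ⊆S₀)) (<⇒≱ (n<1+n 3))
    where
    α≢y : ∀ {α} → α ∈ S₁ → α ≢ y
    α≢y α∈S₁ refl = y∉S₁ α∈S₁

    distinct : Unique (c i ∷ α₁ ∷ α₂ ∷ y ∷ [])
    distinct = (c-i≢α₁ ∷ c-i≢α₂ ∷ y≢c-i ∘ sym ∷ [])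
             ∷ (α₁≢α₂ ∷ α≢y α₁∈S₁ ∷ [])
             ∷ (α≢y α₂∈S₁ ∷ [])
             ∷ [] ∷ []

    ⊆S₀ : All (_∈ S₀) (c i ∷ α₁ ∷ α₂ ∷ y ∷ [])
    ⊆S₀ = c-i∈S₀ ∷ α₁∈S₀ ∷ α₂∈S₀ ∷ y∈S₀ ∷ []

lemma4p2 : (k : ℕ) → .{{_ : NonZero k}} → 3 ≤ k → k % 2 ≡ 1 →
           (S : ListAssignment3 k) → IsSize3 S →
           (c c′ : Fin k → ℤ) →
           ProperOnCycle k c → ¬ Extendable k S c →
           ProperOnCycle k c′ → ¬ Extendable k S c′ →
           ∀ i → c i ≡ c′ i
lemma4p2 k 3≤k _ S size3 c c′ c-proper ¬ext c′-proper ¬ext′ i =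
  ∖≡⁅⁆-unique (missing c c-proper ¬ext) (missing c′ c′-proper ¬ext′)
  where
  missing : ∀ d → ProperOnCycle k d → ¬ Extendable k S d → S i ∖ S (rotate i 1) ≡⁅ d i ⁆
  missing d d-proper ¬ext-d = nonExtendable⇒missing-colour k (<⇒≤ 3≤k) S size3 d d-proper ¬ext-d i
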